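{- Let $G=(V,E)$ be an undirected connected graph, $\mathfrak{G}^S$ a CFI-graph over $G$, and $x\in\mathrm{HF}(\widehat{E})$. If $A_1,A_2\subseteq E$ are CFI-supports of $x$, then $A_1\cap A_2$ is also a CFI-support of $x$.
   Context: $\widehat{E}=\{e_0,e_1\mid e\in E\}$ is the set of edge-gadget vertices of the CFI-graph $\mathfrak{G}^S$ over $G$ (the CFI-graph has vertices $e_0,e_1$ for $e\in E$ and vertex-gadget vertices $v^X$, $X\subseteq E(v)$ of parity determined by whether $v\in S$, with edges $\{e_0,e_1\}$ and $\{v^X,e_i\}$ for $e\in E(v)$, $i=|X\cap\{e\}|$). Hereditarily finite sets: $\mathrm{HF}_0=\widehat{E}\cup\{\emptyset\}$, $\mathrm{HF}_{i+1}=\mathrm{HF}_i\cup2^{\mathrm{HF}_i}$, $\mathrm{HF}(\widehat{E})=\bigcup_i\mathrm{HF}_i$. For $F\subseteq E$, the edge flip $\rho_F$ is the permutation of $\widehat{E}$ swapping $e_0$ and $e_1$ for every $e\in F$ and fixing all other atoms; it acts on $\mathrm{HF}(\widehat{E})$ by $\rho_F(x)=\{\rho_F(y)\mid y\in x\}$. A CFI-support of $x$ is a set $A\subseteq E$ such that every $\rho_F$ with $F\subseteq E$, $F\cap A=\emptyset$, satisfies $\rho_F(x)=x$. -}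

module Defs where

open import Data.Nat using (ℕ)
open import Data.Fin using (Fin)
open import Data.Fin.Subset using (Subset; _∩_; Empty)
open import Data.Bool using (Bool; true; false; not; if_then_else_)
open import Data.List using (List; []; _∷_)
open import Data.Product using (_×_; _,_; ∃; proj₁; proj₂)
open import Data.Sum using (_⊎_)
open import Data.Empty using (⊥)
open import Data.Unit using (⊤)
open import Data.Vec using (lookup)
open import Relation.Binary.PropositionalEquality using (_≡_; _≢_)
open import Relation.Nullary using (¬_)

record Graph : Set where
  field
    n     : ℕ
    m     : ℕ
    ends  : Fin m → Fin n × Fin n
    noLoop : ∀ e → proj₁ (ends e) ≢ proj₂ (ends e)
    simple : ∀ e e' → proj₁ (ends e) ≡ proj₁ (ends e') → proj₂ (ends e) ≡ proj₂ (ends e') → e ≡ e'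
    simple' : ∀ e e' → proj₁ (ends e) ≡ proj₂ (ends e') → proj₂ (ends e) ≡ proj₁ (ends e') → e ≡ e'

open Graph public

Adj : (G : Graph) → Fin (n G) → Fin (n G) → Set
Adj G u v = ∃ λ e → (ends G e ≡ (u , v)) ⊎ (ends G e ≡ (v , u))

data Reach (G : Graph) : Fin (n G) → Fin (n G) → Set where
  here : ∀ {u} → Reach G u u
  step : ∀ {u v w} → Adj G u v → Reach G v w → Reach G u w

Connected : Graph → Set
Connected G = ∀ u v → Reach G u v

-- Hereditarily finite sets over the atoms Ê = {e_0, e_1 | e ∈ E}.
-- The atom e_i is  atom e i  with i : Bool (false = 0, true = 1).
-- A set is given by a finite list of its elements; equality of HF sets
-- is extensional equality _≈_ (atoms are urelements, distinct from sets).
-- set [] is the empty set.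

data HF (m : ℕ) : Set where
  atom : Fin m → Bool → HF m
  set  : List (HF m) → HF m

mutual
  _≈_ : ∀ {m} → HF m → HF m → Set
  atom e i ≈ atom e' i' = (e ≡ e') × (i ≡ i')
  atom _ _ ≈ set _      = ⊥
  set _    ≈ atom _ _   = ⊥
  set xs   ≈ set ys     = (xs ⊆ₗ ys) × (ys ⊆ₗ xs)

  _⊆ₗ_ : ∀ {m} → List (HF m) → List (HF m) → Set
  []       ⊆ₗ ys = ⊤
  (x ∷ xs) ⊆ₗ ys = (x ∈ₗ ys) × (xs ⊆ₗ ys)

  _∈ₗ_ : ∀ {m} → HF m → List (HF m) → Set
  x ∈ₗ []       = ⊥
  x ∈ₗ (y ∷ ys) = (x ≈ y) ⊎ (x ∈ₗ ys)

mutual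
  ρ : ∀ {m} → Subset m → HF m → HF m
  ρ F (atom e i) = atom e (if lookup F e then not i else i)
  ρ F (set xs)   = set (ρs F xs)

  ρs : ∀ {m} → Subset m → List (HF m) → List (HF m)
  ρs F []       = []
  ρs F (x ∷ xs) = ρ F x ∷ ρs F xs

IsCFISupport : ∀ {m} → Subset m → HF m → Set
IsCFISupport {m} A x = ∀ (F : Subset m) → Empty (F ∩ A) → ρ F x ≈ x

-- Edge flips commute and compose by symmetric difference, ρ F ∘ ρ G = ρ (F △ G).
-- A flip F avoiding A₁ ∩ A₂ therefore splits as the flip of F ∖ A₁, which avoids A₁,
-- followed by the flip of F ∩ A₁, which avoids A₂; each of them fixes x.
module Submission where

open import Defs
open import Data.Bool using (Bool; true; false; not; if_then_else_; _∧_; _xor_)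
open import Data.Bool.Properties using (xor-assoc)
open import Data.Fin.Subset using (Subset; _∩_; ∁; Empty)
open import Data.Fin.Subset.Properties using (∩-assoc; x∈p∩q⁻; x∈∁p⇒x∉p)
open import Data.List using (List; []; _∷_)
open import Data.Nat using (ℕ)
open import Data.Product using (_,_; proj₂)
open import Data.Sum using (inj₁; inj₂)
open import Data.Unit using (tt)
open import Data.Vec using ([]; _∷_; zipWith; lookup)
open import Data.Vec.Properties using (lookup-zipWith)
open import Relation.Binary.PropositionalEquality
  using (_≡_; refl; sym; cong; cong₂; subst; module ≡-Reasoning)

infixr 6 _△_

_△_ : ∀ {m} → Subset m → Subset m → Subset m
p △ q = zipWith _xor_ p q

module _ {m : ℕ} where

  mutual
    ≈-trans : (x y z : HF m) → x ≈ y → y ≈ z → x ≈ z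
    ≈-trans (atom _ _) (atom _ _) (atom _ _) (refl , refl) (refl , refl) = refl , refl
    ≈-trans (set xs) (set ys) (set zs) (xs⊆ys , ys⊆xs) (ys⊆zs , zs⊆ys) =
      ⊆ₗ-trans xs ys zs xs⊆ys ys⊆zs , ⊆ₗ-trans zs ys xs zs⊆ys ys⊆xs

    ⊆ₗ-trans : (xs ys zs : List (HF m)) → xs ⊆ₗ ys → ys ⊆ₗ zs → xs ⊆ₗ zs
    ⊆ₗ-trans []       ys zs _                ys⊆zs = tt
    ⊆ₗ-trans (x ∷ xs) ys zs (x∈ys , xs⊆ys) ys⊆zs =
      ∈ₗ-⊆ₗ x ys zs x∈ys ys⊆zs , ⊆ₗ-trans xs ys zs xs⊆ys ys⊆zs

    ∈ₗ-⊆ₗ : (x : HF m) (ys zs : List (HF m)) → x ∈ₗ ys → ys ⊆ₗ zs → x ∈ₗ zs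
    ∈ₗ-⊆ₗ x (y ∷ ys) zs (inj₁ x≈y)  (y∈zs , _)  = ≈-∈ₗ x y zs x≈y y∈zs
    ∈ₗ-⊆ₗ x (y ∷ ys) zs (inj₂ x∈ys) (_ , ys⊆zs) = ∈ₗ-⊆ₗ x ys zs x∈ys ys⊆zs

    ≈-∈ₗ : (x y : HF m) (zs : List (HF m)) → x ≈ y → y ∈ₗ zs → x ∈ₗ zs
    ≈-∈ₗ x y (z ∷ zs) x≈y (inj₁ y≈z)  = inj₁ (≈-trans x y z x≈y y≈z)
    ≈-∈ₗ x y (z ∷ zs) x≈y (inj₂ y∈zs) = inj₂ (≈-∈ₗ x y zs x≈y y∈zs)

  mutual
    ρ-cong : (F : Subset m) (x y : HF m) → x ≈ y → ρ F x ≈ ρ F y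
    ρ-cong F (atom _ _) (atom _ _) (refl , refl)    = refl , refl
    ρ-cong F (set xs)   (set ys)   (xs⊆ys , ys⊆xs) = ρs-⊆ₗ F xs ys xs⊆ys , ρs-⊆ₗ F ys xs ys⊆xs

    ρs-⊆ₗ : (F : Subset m) (xs ys : List (HF m)) → xs ⊆ₗ ys → ρs F xs ⊆ₗ ρs F ys
    ρs-⊆ₗ F []       ys _                = tt
    ρs-⊆ₗ F (x ∷ xs) ys (x∈ys , xs⊆ys) = ρ-∈ₗ F x ys x∈ys , ρs-⊆ₗ F xs ys xs⊆ys

    ρ-∈ₗ : (F : Subset m) (x : HF m) (ys : List (HF m)) → x ∈ₗ ys → ρ F x ∈ₗ ρs F ys
    ρ-∈ₗ F x (y ∷ ys) (inj₁ x≈y)  = inj₁ (ρ-cong F x y x≈y)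
    ρ-∈ₗ F x (y ∷ ys) (inj₂ x∈ys) = inj₂ (ρ-∈ₗ F x ys x∈ys)

  if-not≡xor : ∀ b i → (if b then not i else i) ≡ b xor i
  if-not≡xor true  i = refl
  if-not≡xor false i = refl

  mutual
    ρ-∘ : (F G : Subset m) (x : HF m) → ρ F (ρ G x) ≡ ρ (F △ G) x
    ρ-∘ F G (atom e i) = cong (atom e) (begin
      (if lookup F e then not flipG else flipG) ≡⟨ if-not≡xor (lookup F e) flipG ⟩
      lookup F e xor flipG                      ≡⟨ cong (lookup F e xor_) (if-not≡xor (lookup G e) i) ⟩
      lookup F e xor (lookup G e xor i)         ≡⟨ sym (xor-assoc (lookup F e) (lookup G e) i) ⟩
      (lookup F e xor lookup G e) xor i         ≡⟨ cong (_xor i) (sym (lookup-zipWith _xor_ e F G)) ⟩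
      lookup (F △ G) e xor i                    ≡⟨ sym (if-not≡xor (lookup (F △ G) e) i) ⟩
      (if lookup (F △ G) e then not i else i)   ∎)
      where
        open ≡-Reasoning
        flipG : Bool
        flipG = if lookup G e then not i else i
    ρ-∘ F G (set xs) = cong set (ρs-∘ F G xs)

    ρs-∘ : (F G : Subset m) (xs : List (HF m)) → ρs F (ρs G xs) ≡ ρs (F △ G) xs
    ρs-∘ F G []       = refl
    ρs-∘ F G (x ∷ xs) = cong₂ _∷_ (ρ-∘ F G x) (ρs-∘ F G xs)

  ρ-fixed-△ : (F G : Subset m) (x : HF m) → ρ F x ≈ x → ρ G x ≈ x → ρ (F △ G) x ≈ x
  ρ-fixed-△ F G x ρFx≈x ρGx≈x =
    subst (_≈ x) (ρ-∘ F G x)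
      (≈-trans (ρ F (ρ G x)) (ρ F x) x (ρ-cong F (ρ G x) x ρGx≈x) ρFx≈x)

p≡p∩∁q△p∩q : ∀ {m} (p q : Subset m) → p ≡ (p ∩ ∁ q) △ (p ∩ q)
p≡p∩∁q△p∩q []      []      = refl
p≡p∩∁q△p∩q (a ∷ p) (b ∷ q) = cong₂ _∷_ (a≡a∧¬b⊕a∧b a b) (p≡p∩∁q△p∩q p q)
  where
    a≡a∧¬b⊕a∧b : ∀ a b → a ≡ (a ∧ not b) xor (a ∧ b)
    a≡a∧¬b⊕a∧b true  true  = refl
    a≡a∧¬b⊕a∧b true  false = refl
    a≡a∧¬b⊕a∧b false b     = refl

p∩∁q∩q-Empty : ∀ {m} (p q : Subset m) → Empty ((p ∩ ∁ q) ∩ q)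
p∩∁q∩q-Empty p q (e , e∈p∩∁q∩q) with x∈p∩q⁻ (p ∩ ∁ q) q e∈p∩∁q∩q
... | e∈p∩∁q , e∈q = x∈∁p⇒x∉p (proj₂ (x∈p∩q⁻ p (∁ q) e∈p∩∁q)) e∈q

IsCFISupport-∩ : ∀ {m} (x : HF m) (A₁ A₂ : Subset m) →
                 IsCFISupport A₁ x → IsCFISupport A₂ x → IsCFISupport (A₁ ∩ A₂) x
IsCFISupport-∩ x A₁ A₂ supp₁ supp₂ F F∩A₁∩A₂-Empty =
  subst (λ F′ → ρ F′ x ≈ x) (sym (p≡p∩∁q△p∩q F A₁))
    (ρ-fixed-△ (F ∩ ∁ A₁) (F ∩ A₁) x
      (supp₁ (F ∩ ∁ A₁) (p∩∁q∩q-Empty F A₁))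
      (supp₂ (F ∩ A₁) (subst Empty (sym (∩-assoc F A₁ A₂)) F∩A₁∩A₂-Empty)))

lemma3p8 : (G : Graph) → Connected G → (S : Subset (n G)) → (x : HF (m G)) → (A₁ A₂ : Subset (m G)) → IsCFISupport A₁ x → IsCFISupport A₂ x → IsCFISupport (A₁ ∩ A₂) x
lemma3p8 G _ _ = IsCFISupport-∩
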